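{- Let $G$ be a weighted tree with predictions satisfying $(1-\varepsilon)d_G(v,g)\le f(v)\le(1+\varepsilon)d_G(v,g)$ for all $v$, for a known $\varepsilon\in(0,1)$. Then on every iteration $i$, the distance travelled by the algorithm described in the context satisfies $$(1-\varepsilon)\,d_{G_i}(v_{i-1},v_i)\le\Delta_i+2\varepsilon\, d_G(v_i,g).$$ Additionally, if the predictions also satisfy $f(v)\le d_G(v,g)$ for all $v$, then $d_{G_i}(v_{i-1},v_i)\le\Delta_i+\varepsilon\, d_G(v_i,g)$.
   Context: Exploration setting: $G=(V,E)$ is a finite undirected tree with positive edge weights and shortest-path distance $d_G$, root $r$, unknown goal $g$ recognized upon visiting. For $S\subseteq V$, $\partial S$ is the set of vertices outside $S$ adjacent to $S$. Having visited $V_{i-1}$, the agent knows only the subgraph $G_i$ with vertex set $V_{i-1}\cup\partial V_{i-1}$ and all edges incident to $V_{i-1}$, and the predictions $f$ at those vertices. Let $S_{\varepsilon,r}=\{v\in V: d_G(v,r)\le\frac{1}{1-\varepsilon}f(r)\}$. The algorithm: $v_0=r$, $V_0=\{r\}$; while $v_{i-1}\ne g$, choose $v_i\in\arg\min_{v\in\partial V_{i-1}\cap S_{\varepsilon,r}}\big(d_{G_i}(v_{i-1},v)+f(v)\big)$, travel there along a shortest path in $G_i$, and set $V_i=\{v_0,\dots,v_i\}$. The progress on iteration $i$ is $\Delta_i=d_G(v_{i-1},g)-d_G(v_i,g)$.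
   Formalization: The edge weights, the predictions f, the parameter ε and the distances $d_G$ and $d_{G_i}$ are rational. -}

module Defs where

open import Data.Nat using (ℕ; suc) renaming (_≤_ to _≤ℕ_)
open import Data.Fin using (Fin)
open import Data.List using (List; []; _∷_; length)
open import Data.List.Relation.Unary.Linked using (Linked)
open import Data.List.Relation.Unary.Unique.Propositional using (Unique)
open import Data.Rational using (ℚ; 0ℚ; 1ℚ; _+_; _-_; _*_; _≤_; _<_)
open import Data.Product using (Σ; ∃; _×_)
open import Data.Sum using (_⊎_)
open import Relation.Nullary using (¬_)
open import Data.Empty using (⊥)
open import Relation.Binary.PropositionalEquality using (_≡_; _≢_)

-- A (simple, undirected) graph on the vertex set Fin n with edge weights.
-- Only the values  w u v  with  Adj u v  are meaningful.
record WGraph (n : ℕ) : Set₁ where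
  field
    Adj     : Fin n → Fin n → Set
    w       : Fin n → Fin n → ℚ
    adj-sym : ∀ u v → Adj u v → Adj v u
    irrefl  : ∀ u → ¬ Adj u u
    w-sym   : ∀ u v → Adj u v → w u v ≡ w v u
    w-pos   : ∀ u v → Adj u v → 0ℚ < w u v

module _ {n : ℕ} where

  endpoint : Fin n → List (Fin n) → Fin n
  endpoint u []       = u
  endpoint u (x ∷ xs) = endpoint x xs

  Walk : (Fin n → Fin n → Set) → Fin n → Fin n → List (Fin n) → Set
  Walk R u v xs = Linked R (u ∷ xs) × endpoint u xs ≡ v

  weight : (Fin n → Fin n → ℚ) → List (Fin n) → ℚ
  weight w []           = 0ℚ
  weight w (x ∷ [])     = 0ℚ
  weight w (x ∷ y ∷ xs) = w x y + weight w (y ∷ xs)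

module _ {n : ℕ} (G : WGraph n) where
  open WGraph G

  Connected : Set
  Connected = ∀ u v → ∃ λ xs → Walk Adj u v xs

  Cycle : List (Fin n) → Set
  Cycle []       = ⊥
  Cycle (x ∷ xs) = 2 ≤ℕ length xs × Unique (x ∷ xs) × Linked Adj (x ∷ xs)
                   × Adj (endpoint x xs) x

  IsTree : Set
  IsTree = Connected × (∀ cs → ¬ Cycle cs)

  IsDistIn : (Fin n → Fin n → Set) → Fin n → Fin n → ℚ → Set
  IsDistIn R a b D =
    (∃ λ xs → Walk R a b xs × weight w (a ∷ xs) ≡ D)
    × (∀ xs → Walk R a b xs → D ≤ weight w (a ∷ xs))

  IsDistFn : (Fin n → Fin n → ℚ) → Set
  IsDistFn dG = ∀ a b → IsDistIn Adj a b (dG a b)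

  -- The exploration algorithm, for a sequence of vertices  v : ℕ → Fin n.
  -- Iteration  suc j  (= i) has visited set V_{i-1} = {v 0, …, v j}.
  module Run (dG : Fin n → Fin n → ℚ) (f : Fin n → ℚ) (ε : ℚ)
             (r g : Fin n) (v : ℕ → Fin n) where

    InV : ℕ → Fin n → Set
    InV j x = ∃ λ m → m ≤ℕ j × v m ≡ x

    Bd : ℕ → Fin n → Set
    Bd j x = ¬ InV j x × ∃ λ u → InV j u × Adj u x

    -- x ∈ S_{ε,r} :  d_G(x,r) ≤ f(r)/(1-ε), written with the (positive)
    -- factor 1-ε multiplied out
    InS : Fin n → Set
    InS x = (1ℚ - ε) * dG x r ≤ f r

    -- edges of G_{suc j}: edges of G incident to V_j
    Allowed : ℕ → Fin n → Fin n → Set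
    Allowed j a b = Adj a b × (InV j a ⊎ InV j b)

    -- v (suc j) is a valid choice of the algorithm on iteration suc j
    -- (the loop is entered, i.e. v j ≠ g, and v (suc j) is an argmin)
    Choice : ℕ → Set
    Choice j =
      v j ≢ g × Bd j (v (suc j)) × InS (v (suc j))
      × (∃ λ D → IsDistIn (Allowed j) (v j) (v (suc j)) D
           × (∀ x → Bd j x → InS x → ∀ D' → IsDistIn (Allowed j) (v j) x D'
                → D + f (v (suc j)) ≤ D' + f x))

    RunUpTo : ℕ → Set
    RunUpTo k = v 0 ≡ r × (∀ j → j ≤ℕ k → Choice j)

    -- progress Δ_{suc k}
    Δ : ℕ → ℚ
    Δ k = dG (v k) g - dG (v (suc k)) g

{-# OPTIONS --safe #-}
module Submission where

-- Let u be the vertex where a shortest walk from v_{i-1} to g first leaves V_{i-1},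
-- entered from p ∈ V_{i-1} after a walk of length W inside G_i. Since V_{i-1} is
-- connected, contains r, and G is a tree, the edge p–u separates r from g, so u lies
-- on the r–g path: d(u,r) ≤ d(r,g) ≤ f(r)/(1-ε), i.e. u is a candidate. Hence
-- d_{G_i}(v_{i-1},v_i) + f(v_i) ≤ W + f(u), where W + d(u,g) ≤ d(v_{i-1},g); the
-- prediction bounds and d(u,g) ≤ d(v_{i-1},g) ≤ d_{G_i}(v_{i-1},v_i) + d(v_i,g)
-- then give both inequalities by linear arithmetic.

open import Defs
open import Level using (0ℓ)
open import Data.Nat using (ℕ; zero; suc; z≤n; s≤s) renaming (_≤_ to _≤ℕ_)
import Data.Nat.Properties as ℕ
open import Data.Fin using (Fin) renaming (_≟_ to _≟F_)
open import Data.List using (List; []; _∷_; _++_)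
open import Data.List.Relation.Unary.Linked as Linked using (Linked; []; [-]; _∷_)
open import Data.List.Relation.Unary.Unique.Propositional using (Unique)
open import Data.List.Relation.Unary.AllPairs using ([]; _∷_)
open import Data.List.Relation.Unary.All using (All; []; _∷_)
open import Data.List.Relation.Unary.All.Properties using (¬Any⇒All¬)
open import Data.List.Relation.Unary.Any using (here; there)
open import Data.List.Membership.Propositional using (_∈_)
import Data.List.Membership.DecPropositional as DecMembership
open import Data.Rational using (ℚ; 0ℚ; 1ℚ; _+_; _-_; _*_; _≤_; _<_; _/_; -_; nonNegative)
open import Data.Rational.Properties
open import Data.Rational.Solver using (module +-*-Solver)
open import Data.Integer using (+_)
open import Data.Product using (∃; ∃₂; _×_; _,_; proj₁; proj₂; map₁; map₂)
open import Data.Sum using (inj₁; inj₂; [_,_])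
open import Data.Empty using (⊥-elim)
open import Function using (id)
open import Relation.Nullary using (¬_; yes; no)
open import Relation.Nullary.Decidable using (map′)
open import Relation.Unary using (Pred; Decidable)
open import Relation.Binary using (Rel; _⇒_; Symmetric)
open import Relation.Binary.Construct.Union using (_∪_)
open import Relation.Binary.PropositionalEquality hiding ([_])

open +-*-Solver
open ≤-Reasoning

p≤q⇒0≤q-p : ∀ {p q} → p ≤ q → 0ℚ ≤ q - p
p≤q⇒0≤q-p {p} {q} p≤q = subst (_≤ q - p) (+-inverseʳ p) (+-monoˡ-≤ (- p) p≤q)

≤-by-difference : ∀ {p q x y} → q - p ≡ y - x → x ≤ y → p ≤ q
≤-by-difference {p} {q} {x} {y} same-gap x≤y = begin
  p             ≡⟨ sym (+-identityʳ p) ⟩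
  p + 0ℚ        ≤⟨ +-monoʳ-≤ p (subst (0ℚ ≤_) (sym same-gap) (p≤q⇒0≤q-p x≤y)) ⟩
  p + (q - p)   ≡⟨ solve 2 (λ p q → p :+ (q :- p) := q) refl p q ⟩
  q             ∎

p≤q+p : ∀ {p q} → 0ℚ ≤ q → p ≤ q + p
p≤q+p {p} {q} = ≤-by-difference (solve 2 (λ p q → (q :+ p) :- p := q :- con 0ℚ) refl p q)

p≤p+q : ∀ {p q} → 0ℚ ≤ q → p ≤ p + q
p≤p+q {p} {q} = ≤-by-difference (solve 2 (λ p q → (p :+ q) :- p := q :- con 0ℚ) refl p q)

+-cancelʳ-≤ : ∀ {p q r} → p + r ≤ q + r → p ≤ q
+-cancelʳ-≤ {p} {q} {r} = ≤-by-difference (solve 3 (λ p q r → q :- p := (q :+ r) :- (p :+ r)) refl p q r)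

module _ {ε D W fᵤ a b c : ℚ} (chosen≤candidate : D + (1ℚ - ε) * b ≤ W + fᵤ) (W+c≤a : W + c ≤ a) where

  progress-bound : 0ℚ ≤ ε → 0ℚ ≤ W → a ≤ D + b → fᵤ ≤ (1ℚ + ε) * c
                 → (1ℚ - ε) * D ≤ (a - b) + ((+ 2) / 1) * ε * b
  progress-bound 0≤ε 0≤W a≤D+b fᵤ-upper = ≤-by-difference
    (solve 4 (λ ε D a b → ((a :- b) :+ con ((+ 2) / 1) :* ε :* b) :- (con 1ℚ :- ε) :* D
                        := (a :+ ε :* (D :+ b)) :- (D :+ (con 1ℚ :- ε) :* b)) refl ε D a b)
    (begin
      D + (1ℚ - ε) * b   ≤⟨ chosen≤candidate ⟩
      W + fᵤ             ≤⟨ +-monoʳ-≤ W fᵤ-upper ⟩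
      W + (1ℚ + ε) * c   ≡⟨ solve 3 (λ ε W c → W :+ (con 1ℚ :+ ε) :* c := (W :+ c) :+ ε :* c) refl ε W c ⟩
      (W + c) + ε * c    ≤⟨ +-mono-≤ W+c≤a (*-monoˡ-≤-nonNeg ε {{nonNegative 0≤ε}} c≤D+b) ⟩
      a + ε * (D + b)    ∎)
    where
    c≤D+b : c ≤ D + b
    c≤D+b = ≤-trans (≤-trans (p≤q+p 0≤W) W+c≤a) a≤D+b

  progress-bound-underestimate : fᵤ ≤ c → D ≤ (a - b) + ε * b
  progress-bound-underestimate fᵤ≤c = ≤-by-difference
    (solve 4 (λ ε D a b → ((a :- b) :+ ε :* b) :- D := a :- (D :+ (con 1ℚ :- ε) :* b)) refl ε D a b)
    (≤-trans chosen≤candidate (≤-trans (+-monoʳ-≤ W fᵤ≤c) W+c≤a))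

module Walks {n : ℕ} (G : WGraph n) where
  open WGraph G
  open DecMembership (_≟F_ {n}) using (_∈?_)

  private variable
    R S : Rel (Fin n) 0ℓ
    P : Pred (Fin n) 0ℓ
    a b x y : Fin n
    xs ys zs : List (Fin n)
    D D′ : ℚ

  _within_ : Rel (Fin n) 0ℓ → Pred (Fin n) 0ℓ → Rel (Fin n) 0ℓ
  (R within P) x y = R x y × P x × P y

  Avoiding : Fin n → Rel (Fin n) 0ℓ
  Avoiding z = Adj within (z ≢_)

  avoiding-sym : Symmetric (Avoiding x)
  avoiding-sym (e , x≢y , x≢z) = adj-sym _ _ e , x≢z , x≢y

  linked-within : All P xs → Linked R xs → Linked (R within P) xs
  linked-within _                 []      = []
  linked-within _                 [-]     = [-]
  linked-within (px ∷ ps@(py ∷ _)) (e ∷ L) = (e , px , py) ∷ linked-within ps L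

  walk-map : R ⇒ S → Walk R a b xs → Walk S a b xs
  walk-map R⇒S = map₁ (Linked.map R⇒S)

  walk-++ : Walk R a b xs → Walk R b y ys → Walk R a y (xs ++ ys)
  walk-++ {xs = []}     (_ , refl)   walk = walk
  walk-++ {xs = x ∷ xs} (e ∷ L , ends) walk = map₁ (e ∷_) (walk-++ (L , ends) walk)

  weight-++ : ∀ xs ys → endpoint a xs ≡ b → weight w (a ∷ xs ++ ys) ≡ weight w (a ∷ xs) + weight w (b ∷ ys)
  weight-++         []       ys refl = sym (+-identityˡ _)
  weight-++ {a = a} (x ∷ xs) ys ends =
    trans (cong (_+_ (w a x)) (weight-++ xs ys ends)) (sym (+-assoc (w a x) _ _))

  weight-nonneg : Linked Adj (a ∷ xs) → 0ℚ ≤ weight w (a ∷ xs)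
  weight-nonneg {xs = []}    _       = ≤-refl
  weight-nonneg {xs = _ ∷ _} (e ∷ L) = +-mono-≤ (<⇒≤ (w-pos _ _ e)) (weight-nonneg L)

  walk-reverse : Symmetric R → R ⇒ Adj → Walk R a b xs
               → ∃ λ ys → Walk R b a ys × weight w (b ∷ ys) ≡ weight w (a ∷ xs)
  walk-reverse {xs = []} _ _ (_ , refl) = [] , ([-] , refl) , refl
  walk-reverse {a = a} {b} {x ∷ xs} R-sym R⇒Adj (e ∷ L , ends) =
    let ys , ys-walk , ys-weight = walk-reverse R-sym R⇒Adj (L , ends)
    in ys ++ a ∷ [] , walk-++ ys-walk (R-sym e ∷ [-] , refl) , (begin-equality
         weight w (b ∷ ys ++ a ∷ [])       ≡⟨ weight-++ ys (a ∷ []) (proj₂ ys-walk) ⟩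
         weight w (b ∷ ys) + (w x a + 0ℚ)  ≡⟨ cong₂ _+_ ys-weight (+-identityʳ (w x a)) ⟩
         weight w (x ∷ xs) + w x a         ≡⟨ cong (_+_ (weight w (x ∷ xs))) (sym (w-sym a x (R⇒Adj e))) ⟩
         weight w (x ∷ xs) + w a x         ≡⟨ +-comm _ (w a x) ⟩
         w a x + weight w (x ∷ xs)         ∎)

  split-at : x ∈ a ∷ xs → Linked R (a ∷ xs)
           → ∃₂ λ pre suf → Walk R a x pre × Walk R x (endpoint a xs) suf
             × weight w (a ∷ pre) + weight w (x ∷ suf) ≡ weight w (a ∷ xs)
             × (Unique (a ∷ xs) → Unique (x ∷ suf))
  split-at {xs = xs}    (here refl) L = [] , xs , ([-] , refl) , (L , refl) , +-identityˡ _ , id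
  split-at {xs = []}    (there ())  _
  split-at {a = a} {xs = y ∷ _} (there x∈) (e ∷ L) =
    let pre , suf , pre-walk , suf-walk , split , unique = split-at x∈ L
    in y ∷ pre , suf , map₁ (e ∷_) pre-walk , suf-walk ,
       trans (+-assoc (w a y) _ _) (cong (_+_ (w a y)) split) , λ { (_ ∷ u) → unique u }

  loop-erase : R ⇒ Adj → Walk R a b xs
             → ∃ λ ys → Walk R a b ys × Unique (a ∷ ys) × weight w (a ∷ ys) ≤ weight w (a ∷ xs)
  loop-erase {xs = []} _ walk = [] , walk , [] ∷ [] , ≤-refl
  loop-erase {a = a} {xs = x ∷ xs} R⇒Adj (e ∷ L , ends) with loop-erase R⇒Adj (L , ends)
  ... | ys , (L′ , ends′) , unique , shorter with a ∈? x ∷ ys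
  ... | no a∉ = x ∷ ys , (e ∷ L′ , ends′) , ¬Any⇒All¬ _ a∉ ∷ unique , +-monoʳ-≤ (w a x) shorter
  ... | yes a∈ =
    let pre , suf , pre-walk , (L″ , ends″) , split , unique′ = split-at a∈ L′
    in suf , (L″ , trans ends″ ends′) , unique′ unique , (begin
         weight w (a ∷ suf)                        ≤⟨ p≤q+p (weight-nonneg (Linked.map R⇒Adj (proj₁ pre-walk))) ⟩
         weight w (x ∷ pre) + weight w (a ∷ suf)   ≡⟨ split ⟩
         weight w (x ∷ ys)                         ≤⟨ shorter ⟩
         weight w (x ∷ xs)                         ≤⟨ p≤q+p (<⇒≤ (w-pos a x (R⇒Adj e))) ⟩
         w a x + weight w (x ∷ xs)                 ∎)

  tree-no-bypass : IsTree G → R ⇒ Adj → Adj a b → ¬ R a b → ¬ Walk R a b xs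
  tree-no-bypass {a = a} (_ , acyclic) R⇒Adj a~b ¬ab walk with loop-erase R⇒Adj walk
  ... | []          , (_ , refl)       , _      , _ = irrefl a a~b
  ... | _ ∷ []      , (e ∷ [-] , refl) , _      , _ = ¬ab e
  ... | y ∷ z ∷ zs  , (L , refl)       , unique , _ =
    acyclic (a ∷ y ∷ z ∷ zs) (s≤s (s≤s z≤n) , unique , Linked.map R⇒Adj L , adj-sym _ _ a~b)

  tree-cut : IsTree G → Adj x y → Walk (Avoiding y) x a xs → Walk (Avoiding x) y b ys
           → Walk Adj a b zs → y ∈ a ∷ zs
  tree-cut {x} {y} {a = a} {zs = zs} tree x~y x⇝a y⇝b a⇝b with y ∈? a ∷ zs
  ... | yes y∈ = y∈
  ... | no y∉ = ⊥-elim (tree-no-bypass tree [ proj₁ , proj₁ ] x~y ¬xy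
      (walk-++ (walk-map inj₁ x⇝a)
        (walk-++ (walk-map inj₁ (linked-within (¬Any⇒All¬ _ y∉) (proj₁ a⇝b) , proj₂ a⇝b))
          (walk-map inj₂ (proj₁ (proj₂ (walk-reverse avoiding-sym proj₁ y⇝b)))))))
    where
    ¬xy : ¬ (Avoiding y ∪ Avoiding x) x y
    ¬xy (inj₁ (_ , _ , y≢y)) = y≢y refl
    ¬xy (inj₂ (_ , x≢x , _)) = x≢x refl

  record Exit (P : Pred (Fin n) 0ℓ) (a b : Fin n) (xs : List (Fin n)) : Set where
    field
      last-in first-out    : Fin n
      before after         : List (Fin n)
      last-in∈P            : P last-in
      first-out∉P          : ¬ P first-out
      crossing             : Adj last-in first-out
      before-walk          : Walk (λ x y → Adj x y × P x) a first-out before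
      after-walk           : Walk (Avoiding last-in) first-out b after
      weight-split         : weight w (a ∷ before) + weight w (first-out ∷ after) ≡ weight w (a ∷ xs)

  first-exit : Decidable P → Walk Adj a b xs → Unique (a ∷ xs) → P a → ¬ P b → Exit P a b xs
  first-exit {xs = []} _ (_ , refl) _ Pa ¬Pb = ⊥-elim (¬Pb Pa)
  first-exit {a = a} {xs = x ∷ xs} P? (e ∷ L , ends) (a∉ ∷ unique) Pa ¬Pb with P? x
  ... | no ¬Px = record
    { last-in = a ; first-out = x ; before = x ∷ [] ; after = xs
    ; last-in∈P = Pa ; first-out∉P = ¬Px ; crossing = e
    ; before-walk = (e , Pa) ∷ [-] , refl
    ; after-walk = linked-within a∉ L , ends
    ; weight-split = cong (_+ weight w (x ∷ xs)) (+-identityʳ (w a x))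
    }
  ... | yes Px = record
    { last-in = last-in ; first-out = first-out ; before = x ∷ before ; after = after
    ; last-in∈P = last-in∈P ; first-out∉P = first-out∉P ; crossing = crossing
    ; before-walk = map₁ ((e , Pa) ∷_) before-walk
    ; after-walk = after-walk
    ; weight-split = trans (+-assoc (w a x) _ _) (cong (_+_ (w a x)) weight-split)
    }
    where open Exit (first-exit P? (L , ends) unique Px ¬Pb)

  isDistIn-≤ : IsDistIn G R a b D → IsDistIn G R a b D′ → D ≤ D′
  isDistIn-≤ (_ , minimal) ((xs , walk , refl) , _) = minimal xs walk

  isDistIn-nonneg : R ⇒ Adj → IsDistIn G R a b D → 0ℚ ≤ D
  isDistIn-nonneg R⇒Adj ((_ , walk , refl) , _) = weight-nonneg (Linked.map R⇒Adj (proj₁ walk))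

module Distances {n : ℕ} (G : WGraph n) (dG : Fin n → Fin n → ℚ) (isDist : IsDistFn G dG) where
  open WGraph G
  open Walks G

  private variable
    R : Rel (Fin n) 0ℓ
    a b x : Fin n
    xs : List (Fin n)
    D : ℚ

  dist-≤-weight : Walk Adj a b xs → dG a b ≤ weight w (a ∷ xs)
  dist-≤-weight {a} {b} {xs} = proj₂ (isDist a b) xs

  dist-≤-isDistIn : R ⇒ Adj → IsDistIn G R a b D → dG a b ≤ D
  dist-≤-isDistIn R⇒Adj ((_ , walk , refl) , _) = dist-≤-weight (walk-map R⇒Adj walk)

  dist-sym-≤ : ∀ a b → dG b a ≤ dG a b
  dist-sym-≤ a b =
    let xs , walk , xs-weight = proj₁ (isDist a b)
        _ , reversed , reversed-weight = walk-reverse (adj-sym _ _) id walk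
    in subst (dG b a ≤_) (trans reversed-weight xs-weight) (dist-≤-weight reversed)

  dist-triangle : ∀ a b c → dG a c ≤ dG a b + dG b c
  dist-triangle a b c =
    let xs , a⇝b , xs-weight = proj₁ (isDist a b)
        ys , b⇝c , ys-weight = proj₁ (isDist b c)
    in subst (dG a c ≤_) (trans (weight-++ xs ys (proj₂ a⇝b)) (cong₂ _+_ xs-weight ys-weight))
             (dist-≤-weight (walk-++ a⇝b b⇝c))

  dist-≤-on-shortest-walk : Walk Adj a b xs → weight w (a ∷ xs) ≡ dG a b → x ∈ a ∷ xs → dG a x ≤ dG a b
  dist-≤-on-shortest-walk {a} {b} {xs} {x} walk shortest x∈ =
    let pre , suf , pre-walk , suf-walk , split , _ = split-at x∈ (proj₁ walk)
    in begin
      dG a x                                    ≤⟨ dist-≤-weight pre-walk ⟩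
      weight w (a ∷ pre)                        ≤⟨ p≤p+q (weight-nonneg (proj₁ suf-walk)) ⟩
      weight w (a ∷ pre) + weight w (x ∷ suf)   ≡⟨ trans split shortest ⟩
      dG a b                                    ∎

  shortest-simple-walk : ∀ a b → ∃ λ xs → Walk Adj a b xs × Unique (a ∷ xs) × weight w (a ∷ xs) ≤ dG a b
  shortest-simple-walk a b =
    let xs , walk , xs-weight = proj₁ (isDist a b)
        ys , simple , unique , shorter = loop-erase id walk
    in ys , simple , unique , ≤-trans shorter (≤-reflexive xs-weight)

module Exploration {n : ℕ} (G : WGraph n) (tree : IsTree G)
  (dG : Fin n → Fin n → ℚ) (isDist : IsDistFn G dG) (f : Fin n → ℚ) (ε : ℚ)
  (r g : Fin n) (v : ℕ → Fin n) (k : ℕ) (run : Run.RunUpTo G dG f ε r g v k) where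
  open WGraph G
  open Run G dG f ε r g v
  open Walks G
  open Distances G dG isDist

  private variable
    i j : ℕ
    x : Fin n
    D : ℚ

  InV? : ∀ j → Decidable (InV j)
  InV? j x = map′ (λ (m , m<1+j , e) → m , ℕ.≤-pred m<1+j , e) (λ (m , m≤j , e) → m , s≤s m≤j , e)
                  (ℕ.anyUpTo? (λ m → v m ≟F x) (suc j))

  InV-mono : i ≤ℕ j → InV i x → InV j x
  InV-mono i≤j (m , m≤i , e) = m , ℕ.≤-trans m≤i i≤j , e

  -- v (suc j) was chosen in ∂V_j, so it has a neighbour visited earlier.
  visited-reaches-root : j ≤ℕ k → InV j x → ∃ λ xs → Walk (Adj within InV k) x r xs
  visited-reaches-root {zero} _ (zero , z≤n , refl) = [] , [-] , proj₁ run
  visited-reaches-root {suc j} j<k (m , m≤1+j , refl) with ℕ.m≤n⇒m<n∨m≡n m≤1+j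
  ... | inj₁ m<1+j = visited-reaches-root (ℕ.<⇒≤ j<k) (m , ℕ.≤-pred m<1+j , refl)
  ... | inj₂ refl with proj₂ run j (ℕ.<⇒≤ j<k)
  ... | _ , (_ , y , y∈V , y~x) , _ =
    let xs , (L , ends) = visited-reaches-root (ℕ.<⇒≤ j<k) y∈V
    in y ∷ xs , (adj-sym _ _ y~x , (suc j , j<k , refl) , InV-mono (ℕ.<⇒≤ j<k) y∈V) ∷ L , ends

  avoid-unvisited : ¬ InV k x → (Adj within InV k) ⇒ Avoiding x
  avoid-unvisited x∉V (e , y∈V , z∈V) = e , (λ { refl → x∉V y∈V }) , (λ { refl → x∉V z∈V })

  goal-unvisited : ¬ InV k g
  goal-unvisited (m , m≤k , vm≡g) = proj₁ (proj₂ run m m≤k) vm≡g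

  on-root-goal-walks⇒InS : 0ℚ ≤ 1ℚ - ε → (1ℚ - ε) * dG r g ≤ f r
                         → (∀ {qs} → Walk Adj r g qs → x ∈ r ∷ qs) → InS x
  on-root-goal-walks⇒InS {x} 0≤1-ε f-r-lower x∈walks =
    let qs , qs-walk , qs-weight = proj₁ (isDist r g)
    in begin
      (1ℚ - ε) * dG x r  ≤⟨ *-monoˡ-≤-nonNeg (1ℚ - ε) {{nonNegative 0≤1-ε}}
                              (≤-trans (dist-sym-≤ r x)
                                (dist-≤-on-shortest-walk qs-walk qs-weight (x∈walks qs-walk))) ⟩
      (1ℚ - ε) * dG r g  ≤⟨ f-r-lower ⟩
      f r                ∎

  chosen-minimises : IsDistIn G (Allowed k) (v k) (v (suc k)) D
                   → ∀ x → Bd k x → InS x → ∀ D′ → IsDistIn G (Allowed k) (v k) x D′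
                   → D + f (v (suc k)) ≤ D′ + f x
  chosen-minimises D-dist with proj₂ run k ℕ.≤-refl
  ... | _ , _ , _ , _ , D₀-dist , argmin = λ x x∈∂V x∈S D′ D′-dist →
    ≤-trans (+-monoˡ-≤ (f (v (suc k))) (isDistIn-≤ D-dist D₀-dist)) (argmin x x∈∂V x∈S D′ D′-dist)

  record Candidate : Set where
    field
      u          : Fin n
      W          : ℚ
      u∈∂V       : Bd k u
      u∈S        : InS u
      W-dist     : IsDistIn G (Allowed k) (v k) u W
      W-progress : W + dG u g ≤ dG (v k) g

  -- The candidate is where a shortest walk from v k to g first leaves V_k.
  candidate : 0ℚ ≤ 1ℚ - ε → (1ℚ - ε) * dG r g ≤ f r → Candidate
  candidate 0≤1-ε f-r-lower with shortest-simple-walk (v k) g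
  ... | ps , ps-walk , ps-unique , ps-short = record
    { u          = first-out
    ; W          = W₀
    ; u∈∂V       = first-out∉P , last-in , last-in∈P , crossing
    ; u∈S        = on-root-goal-walks⇒InS 0≤1-ε f-r-lower (tree-cut tree crossing last-in⇝r after-walk)
    ; W-dist     = (before , walk-map (map₂ inj₁) before-walk , refl) , W₀-minimal
    ; W-progress = begin
        W₀ + dG first-out g  ≤⟨ +-monoʳ-≤ W₀ (dist-≤-weight (walk-map proj₁ after-walk)) ⟩
        W₀ + rest            ≤⟨ W₀+rest≤dist ⟩
        dG (v k) g           ∎
    }
    where
    open Exit (first-exit (InV? k) ps-walk ps-unique (k , ℕ.≤-refl , refl) goal-unvisited)

    W₀ rest : ℚ
    W₀   = weight w (v k ∷ before)
    rest = weight w (first-out ∷ after)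

    W₀+rest≤dist : W₀ + rest ≤ dG (v k) g
    W₀+rest≤dist = ≤-trans (≤-reflexive weight-split) ps-short

    last-in⇝r : Walk (Avoiding first-out) last-in r _
    last-in⇝r = walk-map (avoid-unvisited first-out∉P)
                         (proj₂ (visited-reaches-root ℕ.≤-refl last-in∈P))

    W₀-minimal : ∀ xs → Walk (Allowed k) (v k) first-out xs → W₀ ≤ weight w (v k ∷ xs)
    W₀-minimal xs walk = +-cancelʳ-≤ (begin
      W₀ + rest                      ≤⟨ W₀+rest≤dist ⟩
      dG (v k) g                     ≤⟨ dist-≤-weight (walk-++ (walk-map proj₁ walk) (walk-map proj₁ after-walk)) ⟩
      weight w (v k ∷ xs ++ after)   ≡⟨ weight-++ xs after (proj₂ walk) ⟩
      weight w (v k ∷ xs) + rest     ∎)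

lemma6 : ∀ {n} (G : WGraph n) → IsTree G
    → (dG : Fin n → Fin n → ℚ) → IsDistFn G dG
    → (f : Fin n → ℚ) (ε : ℚ) → 0ℚ < ε → ε < 1ℚ
    → (r g : Fin n)
    → (∀ x → (1ℚ - ε) * dG x g ≤ f x × f x ≤ (1ℚ + ε) * dG x g)
    → (v : ℕ → Fin n) (k : ℕ) → Run.RunUpTo G dG f ε r g v k
    → (∀ D → IsDistIn G (Run.Allowed G dG f ε r g v k) (v k) (v (suc k)) D
        → ((1ℚ - ε) * D ≤ Run.Δ G dG f ε r g v k + ((+ 2) / 1) * ε * dG (v (suc k)) g)
          × ((∀ x → f x ≤ dG x g)
             → D ≤ Run.Δ G dG f ε r g v k + ε * dG (v (suc k)) g))
lemma6 G tree dG isDist f ε 0<ε ε<1 r g prediction v k run D D-dist =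
    progress-bound {ε = ε} {W = W} chosen≤candidate W-progress (<⇒≤ 0<ε) (isDistIn-nonneg proj₁ W-dist)
                   goal-dist-≤ (proj₂ (prediction u))
  , λ f≤d → progress-bound-underestimate {ε = ε} {W = W} chosen≤candidate W-progress (f≤d u)
  where
  open Walks G
  open Distances G dG isDist
  open Exploration G tree dG isDist f ε r g v k run
  open Candidate (candidate (p≤q⇒0≤q-p (<⇒≤ ε<1)) (proj₁ (prediction r)))

  chosen≤candidate : D + (1ℚ - ε) * dG (v (suc k)) g ≤ W + f u
  chosen≤candidate = ≤-trans (+-monoʳ-≤ D (proj₁ (prediction (v (suc k)))))
                                (chosen-minimises D-dist u u∈∂V u∈S W W-dist)

  goal-dist-≤ : dG (v k) g ≤ D + dG (v (suc k)) g
  goal-dist-≤ = ≤-trans (dist-triangle (v k) (v (suc k)) g) (+-monoˡ-≤ _ (dist-≤-isDistIn proj₁ D-dist))
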